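{- Let $\alpha,\beta>0$ be reals, and let $G$ be an $(\alpha,\beta)$-compliant digraph via a bipartition $(A,B)$ such that $G$ has no directed cycle of length less than four. Then there is a vertex $v\in B$ with $|M_1(v)|+|M_3(v)|\ge(\alpha+\beta)|A|$.
   Context: Digraphs are finite, with no loops and no parallel edges (both $uv$ and $vu$ may be edges). A digraph $G$ with a bipartition $(A,B)$ (of its underlying graph) is $(\alpha,\beta)$-compliant via $(A,B)$ if $G$ is non-null, every vertex in $A$ has at least $\beta|B|$ out-neighbours in $B$, and every vertex in $B$ has at least $\alpha|A|$ out-neighbours in $A$. For a vertex $v$, $M_i(v)$ is the set of vertices $u$ such that the shortest directed path from $u$ to $v$ has exactly $i$ edges.
   Formalization: The parameters α and β range over the positive rationals instead of the positive reals. -}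

module Defs where

open import Data.Nat using (ℕ; zero; suc; _+_; _<_)
open import Data.Bool using (Bool; true; false; _∧_; _∨_; not; if_then_else_)
open import Data.Fin using (Fin; zero; suc; toℕ; fromℕ<)
open import Data.Fin.Properties using () renaming (_≟_ to _≟ᶠ_)
open import Data.Integer using (+_)
open import Data.Rational using (ℚ; _/_) renaming (_+_ to _+ℚ_; _*_ to _*ℚ_; _≤_ to _≤ℚ_)
open import Relation.Nullary.Decidable using (⌊_⌋)
open import Relation.Binary.PropositionalEquality using (_≡_; _≢_)
open import Data.Product using (∃; _×_; Σ-syntax; ∃-syntax)
open import Function using (_∘_)

-- A digraph on vertex set Fin n: adjacency as a Bool-valued relation
-- (so no parallel edges; uv and vu may both be edges).
record Digraph (n : ℕ) : Set where
  field
    adj    : Fin n → Fin n → Bool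
    noLoop : ∀ v → adj v v ≡ false
open Digraph public

ℕ→ℚ : ℕ → ℚ
ℕ→ℚ k = (+ k) / 1

count : ∀ {n} → (Fin n → Bool) → ℕ
count {zero}  p = 0
count {suc n} p = (if p zero then 1 else 0) + count (p ∘ suc)

anyFin : ∀ {n} → (Fin n → Bool) → Bool
anyFin {zero}  p = false
anyFin {suc n} p = p zero ∨ anyFin (p ∘ suc)

anyBelow : ℕ → (ℕ → Bool) → Bool
anyBelow zero    p = false
anyBelow (suc i) p = p i ∨ anyBelow i p

-- A bipartition (A,B) of the underlying graph: side v = true means v ∈ A,
-- side v = false means v ∈ B. Both parts are nonempty, and every edge
-- goes between A and B.
inA inB : ∀ {n} → (Fin n → Bool) → Fin n → Bool
inA side v = side v
inB side v = not (side v)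

record IsBipartition {n : ℕ} (G : Digraph n) (side : Fin n → Bool) : Set where
  field
    A-nonempty : ∃[ a ] side a ≡ true
    B-nonempty : ∃[ b ] side b ≡ false
    edges-cross : ∀ u v → adj G u v ≡ true → side u ≢ side v
open IsBipartition public

outdegIn : ∀ {n} → Digraph n → (Fin n → Bool) → Fin n → ℕ
outdegIn G S v = count (λ w → adj G v w ∧ S w)

record Compliant (α β : ℚ) {n : ℕ} (G : Digraph n) (side : Fin n → Bool) : Set where
  field
    bipartition : IsBipartition G side
    nonNull     : 0 < n
    A-deg : ∀ a → side a ≡ true →
            β *ℚ ℕ→ℚ (count (inB side)) ≤ℚ ℕ→ℚ (outdegIn G (inB side) a)
    B-deg : ∀ b → side b ≡ false →
            α *ℚ ℕ→ℚ (count (inA side)) ≤ℚ ℕ→ℚ (outdegIn G (inA side) b)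
open Compliant public

-- Directed cycles of length 2 and 3 (length 1 would be a loop).
HasCycle2 : ∀ {n} → Digraph n → Set
HasCycle2 G = ∃[ u ] ∃[ v ] (u ≢ v × adj G u v ≡ true × adj G v u ≡ true)

HasCycle3 : ∀ {n} → Digraph n → Set
HasCycle3 G = ∃[ u ] ∃[ v ] ∃[ w ]
  (u ≢ v × v ≢ w × u ≢ w ×
   adj G u v ≡ true × adj G v w ≡ true × adj G w u ≡ true)

walkB : ∀ {n} → Digraph n → ℕ → Fin n → Fin n → Bool
walkB G zero    u v = ⌊ u ≟ᶠ v ⌋
walkB G (suc k) u v = anyFin (λ w → adj G u w ∧ walkB G k w v)

-- inM G i v u = true iff u ∈ M_i(v), i.e. the shortest directed path
-- (equivalently walk) from u to v has exactly i edges
inM : ∀ {n} → Digraph n → ℕ → Fin n → Fin n → Bool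
inM G i v u = walkB G i u v ∧ not (anyBelow i (λ j → walkB G j u v))

sizeM : ∀ {n} → Digraph n → ℕ → Fin n → ℕ
sizeM G i v = count (inM G i v)

{-# OPTIONS --safe #-}
-- Let m be the least number of out-neighbours in B of a vertex of A and k the least
-- number of out-neighbours in A of a vertex of B, so m ≥ β|B| > 0 and k ≥ α|A|. Keep
-- only m out-edges at every vertex of A. In the resulting digraph H, for v ∈ B let d(v)
-- be its in-degree and n₃(v) the number of x with a 3-walk x ⇝ v but no edge x → v;
-- then Σ_B d = m|A|. For x ∈ A and a 2-walk x ⇝ z (so z ∈ A), the out-neighbours y of
-- x with y → z are at most as many as the out-neighbours of z that x misses: x and z
-- both have out-degree m, and an out-neighbour of x cannot be both an in- and an
-- out-neighbour of z, since there are no 2-cycles. As every out-neighbour of x has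
-- out-degree ≥ k, summing gives Σ_B d·n₃ ≥ km|A|, and Cauchy–Schwarz gives
-- |B|·Σ_B d² ≥ (m|A|)². Hence |B|·Σ_B d·(d + n₃) ≥ (m|A| + k|B|)·Σ_B d, so some v ∈ B
-- has |B|·(d + n₃)(v) ≥ m|A| + k|B| ≥ (α + β)|A||B|. Finally the in-neighbours of v lie
-- in M₁(v), and the vertices counted by n₃(v) lie in M₃(v): by parity they have no
-- walk of length 0 or 2 to v.
module Submission where

open import Defs
open import Data.Bool using (Bool; true; false; _∧_; _∨_; not; if_then_else_)
open import Data.Bool.Properties using (¬-not; not-¬; not-involutive; ∧-zeroʳ; ∨-zeroʳ) renaming (_≟_ to _≟ᵇ_)
open import Data.Fin using (Fin; zero; suc)
open import Data.Fin.Properties using (any?) renaming (_≟_ to _≟ᶠ_)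
open import Data.Product using (∃; ∃-syntax; _×_; _,_; proj₁; proj₂)
open import Data.Sum using ([_,_]′)
open import Function using (_∘_; id)
open import Relation.Unary using (Pred; Decidable)
open import Relation.Nullary using (¬_; yes; no; contradiction; _×-dec_)
open import Relation.Nullary.Decidable using (isYes≗does; dec-true; dec-false)
open import Relation.Binary.PropositionalEquality
  using (_≡_; _≢_; _≗_; refl; sym; trans; cong; cong₂; subst; subst₂; module ≡-Reasoning)

-- The ℕ operators are opened only in this block, so that the theorem at the end can
-- use the ℚ ones under the same names.
module _ where
  open import Data.Nat using (ℕ; zero; suc; _+_; _*_; _∸_; _≤_; _<_; z≤n; s≤s; _≤?_; _<?_)
  open import Data.Nat.Properties
  open import Data.Nat.GeneralisedArithmetic using (iterate)
  open import Data.Nat.Tactic.RingSolver using (solve-∀)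
  open import Algebra.Properties.Semiring.Sum +-*-semiring
    using (sum; sum-cong-≗; ∑-distrib-+; ∑-comm; *-distribˡ-sum; *-distribʳ-sum)

  ∧-elim : ∀ {a b} → a ∧ b ≡ true → a ≡ true × b ≡ true
  ∧-elim {true} b≡true = refl , b≡true

  ∧-intro : ∀ {a b} → a ≡ true → b ≡ true → a ∧ b ≡ true
  ∧-intro refl refl = refl

  𝟙 : Bool → ℕ
  𝟙 b = if b then 1 else 0

  sum-mono-≤ : ∀ {n} {f g : Fin n → ℕ} → (∀ i → f i ≤ g i) → sum f ≤ sum g
  sum-mono-≤ {zero}  f≤g = z≤n
  sum-mono-≤ {suc n} f≤g = +-mono-≤ (f≤g zero) (sum-mono-≤ (f≤g ∘ suc))

  count≡sum : ∀ {n} (p : Fin n → Bool) → count p ≡ sum (𝟙 ∘ p)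
  count≡sum {zero}  p = refl
  count≡sum {suc n} p = cong (𝟙 (p zero) +_) (count≡sum (p ∘ suc))

  count-cong : ∀ {n} {p q : Fin n → Bool} → p ≗ q → count p ≡ count q
  count-cong {zero}  p≗q = refl
  count-cong {suc n} p≗q = cong₂ _+_ (cong 𝟙 (p≗q zero)) (count-cong (p≗q ∘ suc))

  count-mono : ∀ {n} {p q : Fin n → Bool} → (∀ i → p i ≡ true → q i ≡ true) → count p ≤ count q
  count-mono {zero}  p⊆q = z≤n
  count-mono {suc n} {p} {q} p⊆q = +-mono-≤ (𝟙-mono (p⊆q zero)) (count-mono (p⊆q ∘ suc))
    where
    𝟙-mono : ∀ {a b} → (a ≡ true → b ≡ true) → 𝟙 a ≤ 𝟙 b
    𝟙-mono {false} a⇒b = z≤n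
    𝟙-mono {true}  a⇒b rewrite a⇒b refl = ≤-refl

  count-pos : ∀ {n} {p : Fin n → Bool} i → p i ≡ true → 0 < count p
  count-pos {p = p} zero    p0 rewrite p0 = s≤s z≤n
  count-pos {p = p} (suc i) pi = ≤-trans (count-pos i pi) (m≤n+m _ (𝟙 (p zero)))

  count-false : ∀ n → count {n} (λ _ → false) ≡ 0
  count-false zero    = refl
  count-false (suc n) = count-false n

  𝟙*count : ∀ {n} b (p : Fin n → Bool) → 𝟙 b * count p ≡ count (λ i → b ∧ p i)
  𝟙*count {n} false p = sym (count-false n)
  𝟙*count true  p = +-identityʳ (count p)

  count-+ : ∀ {n} {p q r : Fin n → Bool} → (∀ i → 𝟙 (r i) ≡ 𝟙 (p i) + 𝟙 (q i)) →
    count r ≡ count p + count q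
  count-+ {p = p} {q} {r} split = begin
    count r                                ≡⟨ count≡sum r ⟩
    sum (𝟙 ∘ r)                            ≡⟨ sum-cong-≗ split ⟩
    sum (λ i → 𝟙 (p i) + 𝟙 (q i))          ≡⟨ ∑-distrib-+ (𝟙 ∘ p) (𝟙 ∘ q) ⟩
    sum (𝟙 ∘ p) + sum (𝟙 ∘ q)              ≡⟨ sym (cong₂ _+_ (count≡sum p) (count≡sum q)) ⟩
    count p + count q                      ∎
    where open ≡-Reasoning

  count-∨ : ∀ {n} (p q : Fin n → Bool) →
    count (λ i → p i ∨ q i) ≡ count p + count (λ i → not (p i) ∧ q i)
  count-∨ p q = count-+ λ i → split (p i) (q i)
    where
    split : ∀ a b → 𝟙 (a ∨ b) ≡ 𝟙 a + 𝟙 (not a ∧ b)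
    split true  b = refl
    split false b = refl

  count-split : ∀ {n} (p q : Fin n → Bool) →
    count p ≡ count (λ i → p i ∧ q i) + count (λ i → p i ∧ not (q i))
  count-split p q = count-+ λ i → split (p i) (q i)
    where
    split : ∀ a b → 𝟙 a ≡ 𝟙 (a ∧ b) + 𝟙 (a ∧ not b)
    split true  true  = refl
    split true  false = refl
    split false b     = refl

  ∑-count-comm : ∀ {m n} (r : Fin m → Fin n → Bool) →
    sum (λ i → count (r i)) ≡ sum (λ j → count (λ i → r i j))
  ∑-count-comm r = begin
    sum (λ i → count (r i))              ≡⟨ sum-cong-≗ (λ i → count≡sum (r i)) ⟩
    sum (λ i → sum (λ j → 𝟙 (r i j)))    ≡⟨ ∑-comm (λ i j → 𝟙 (r i j)) ⟩
    sum (λ j → sum (λ i → 𝟙 (r i j)))    ≡⟨ sym (sum-cong-≗ (λ j → count≡sum (λ i → r i j))) ⟩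
    sum (λ j → count (λ i → r i j))      ∎
    where open ≡-Reasoning

  count*≡∑𝟙* : ∀ {n} (p : Fin n → Bool) c → count p * c ≡ sum (λ i → 𝟙 (p i) * c)
  count*≡∑𝟙* p c = trans (cong (_* c) (count≡sum p)) (*-distribʳ-sum c (𝟙 ∘ p))

  count-∨-≤ : ∀ {n} (p q : Fin n → Bool) → count (λ i → p i ∨ q i) ≤ count p + count q
  count-∨-≤ p q = ≤-trans (≤-reflexive (count-∨ p q))
    (+-monoʳ-≤ (count p) (count-mono λ i → proj₂ ∘ ∧-elim {not (p i)}))

  keepFirst : ∀ {n} → ℕ → (Fin n → Bool) → Fin n → Bool
  keepFirst zero    p i       = false
  keepFirst (suc m) p zero    = p zero
  keepFirst (suc m) p (suc i) = keepFirst (if p zero then m else suc m) (p ∘ suc) i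

  keepFirst⊆ : ∀ {n} m (p : Fin n → Bool) {i} → keepFirst m p i ≡ true → p i ≡ true
  keepFirst⊆ (suc m) p {zero}  kept = kept
  keepFirst⊆ (suc m) p {suc i} kept = keepFirst⊆ (if p zero then m else suc m) (p ∘ suc) kept

  count-keepFirst : ∀ {n} m (p : Fin n → Bool) → m ≤ count p → count (keepFirst m p) ≡ m
  count-keepFirst {zero}  zero    p m≤ = refl
  count-keepFirst {suc n} zero    p m≤ = count-keepFirst {n} zero (p ∘ suc) z≤n
  count-keepFirst {suc n} (suc m) p m≤ with p zero
  ... | true  = cong suc (count-keepFirst m (p ∘ suc) (≤-pred m≤))
  ... | false = count-keepFirst (suc m) (p ∘ suc) m≤

  ∃-argmin : ∀ {n ℓ} {P : Pred (Fin n) ℓ} → Decidable P → (f : Fin n → ℕ) → ∃ P →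
    ∃[ j ] (P j × (∀ i → P i → f j ≤ f i))
  ∃-argmin {suc n} {P = P} P? f (i , Pi) with any? (P? ∘ suc)
  ... | no none = zero , onlyZero i Pi , λ { zero _ → ≤-refl ; (suc j) Pj → contradiction (j , Pj) none }
    where
    onlyZero : ∀ i → P i → P zero
    onlyZero zero    P0 = P0
    onlyZero (suc j) Pj = contradiction (j , Pj) none
  ... | yes rest with ∃-argmin (P? ∘ suc) (f ∘ suc) rest | P? zero
  ...   | j , Pj , min | no ¬P0 = suc j , Pj , λ { zero P0 → contradiction P0 ¬P0 ; (suc i) → min i }
  ...   | j , Pj , min | yes P0 with f zero ≤? f (suc j)
  ...     | yes f0≤ = zero , P0 , λ { zero _ → ≤-refl ; (suc i) Pi → ≤-trans f0≤ (min i Pi) }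
  ...     | no  f0≰ = suc j , Pj , λ { zero _ → ≰⇒≥ f0≰ ; (suc i) → min i }

  ∃-above-average : ∀ {n} (w f : Fin n → ℕ) c → 0 < sum w → c * sum w ≤ sum (λ i → w i * f i) →
    ∃[ i ] (0 < w i × c ≤ f i)
  ∃-above-average w f c 0<∑w avg≤ with any? (λ i → (0 <? w i) ×-dec (c ≤? f i))
  ... | yes found = found
  ... | no  none  = contradiction (≤-trans strictly-below avg≤) (<⇒≱ (m<n+m _ 0<∑w))
    where
    below : ∀ i → w i + w i * f i ≤ c * w i
    below i with 0 <? w i
    ... | no  w≯0 rewrite n≤0⇒n≡0 (≮⇒≥ w≯0) = z≤n
    ... | yes w>0 = begin
      w i + w i * f i  ≡⟨ sym (*-suc (w i) (f i)) ⟩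
      w i * suc (f i)  ≤⟨ *-monoʳ-≤ (w i) (≰⇒> (λ c≤f → none (i , w>0 , c≤f))) ⟩
      w i * c          ≡⟨ *-comm (w i) c ⟩
      c * w i          ∎
      where open ≤-Reasoning
    strictly-below : sum w + sum (λ i → w i * f i) ≤ c * sum w
    strictly-below = begin
      sum w + sum (λ i → w i * f i)  ≡⟨ sym (∑-distrib-+ w (λ i → w i * f i)) ⟩
      sum (λ i → w i + w i * f i)    ≤⟨ sum-mono-≤ below ⟩
      sum (λ i → c * w i)            ≡⟨ sym (*-distribˡ-sum c w) ⟩
      c * sum w                      ∎
      where open ≤-Reasoning

  2ac≤a²+c² : ∀ a c → 2 * (a * c) ≤ a * a + c * c
  2ac≤a²+c² a c = [ ordered , swapped ]′ (≤-total a c)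
    where
    gap : ∀ a t → 2 * (a * (a + t)) + t * t ≡ a * a + (a + t) * (a + t)
    gap = solve-∀
    ordered : ∀ {a c} → a ≤ c → 2 * (a * c) ≤ a * a + c * c
    ordered {a} {c} a≤c = subst (λ c → 2 * (a * c) ≤ a * a + c * c) (m+[n∸m]≡n a≤c)
      (subst (2 * (a * (a + (c ∸ a))) ≤_) (gap a (c ∸ a)) (m≤m+n _ _))
    swapped : c ≤ a → 2 * (a * c) ≤ a * a + c * c
    swapped c≤a = subst₂ _≤_ (cong (2 *_) (*-comm c a)) (+-comm (c * c) (a * a)) (ordered c≤a)

  ∑-2ac≤∑a²+c² : ∀ {n} (g f : Fin n → ℕ) c →
    2 * (c * sum (λ i → g i * f i)) ≤ sum (λ i → g i * f i * f i) + c * c * sum g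
  ∑-2ac≤∑a²+c² g f c = begin
    2 * (c * sum (λ i → g i * f i))                  ≡⟨ cong (2 *_) (*-distribˡ-sum c (λ i → g i * f i)) ⟩
    2 * sum (λ i → c * (g i * f i))                  ≡⟨ *-distribˡ-sum 2 (λ i → c * (g i * f i)) ⟩
    sum (λ i → 2 * (c * (g i * f i)))                ≤⟨ sum-mono-≤ pointwise ⟩
    sum (λ i → g i * f i * f i + c * c * g i)
      ≡⟨ ∑-distrib-+ (λ i → g i * f i * f i) (λ i → c * c * g i) ⟩
    sum (λ i → g i * f i * f i) + sum (λ i → c * c * g i)
      ≡⟨ cong (_ +_) (sym (*-distribˡ-sum (c * c) g)) ⟩
    sum (λ i → g i * f i * f i) + c * c * sum g      ∎
    where
    open ≤-Reasoning
    lhs : ∀ g f c → 2 * (c * (g * f)) ≡ g * (2 * (f * c))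
    lhs = solve-∀
    rhs : ∀ g f c → g * (f * f + c * c) ≡ g * f * f + c * c * g
    rhs = solve-∀
    pointwise : ∀ i → 2 * (c * (g i * f i)) ≤ g i * f i * f i + c * c * g i
    pointwise i = subst₂ _≤_ (sym (lhs (g i) (f i) c)) (rhs (g i) (f i) c)
      (*-monoʳ-≤ (g i) (2ac≤a²+c² (f i) c))

  cauchy-schwarz : ∀ {n} (g f : Fin n → ℕ) →
    sum (λ i → g i * f i) * sum (λ i → g i * f i) ≤ sum g * sum (λ i → g i * f i * f i)
  cauchy-schwarz {zero}  g f = z≤n
  cauchy-schwarz {suc n} g f = begin
    (g₀ * f₀ + S) * (g₀ * f₀ + S)                 ≡⟨ expand g₀ f₀ S ⟩
    g₀ * f₀ * (g₀ * f₀) + S * S + g₀ * (2 * (f₀ * S))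
      ≤⟨ +-mono-≤ (+-monoʳ-≤ _ (cauchy-schwarz (g ∘ suc) (f ∘ suc)))
                  (*-monoʳ-≤ g₀ (∑-2ac≤∑a²+c² (g ∘ suc) (f ∘ suc) f₀)) ⟩
    g₀ * f₀ * (g₀ * f₀) + G * S₂ + g₀ * (S₂ + f₀ * f₀ * G) ≡⟨ collect g₀ f₀ S₂ G ⟩
    (g₀ + G) * (g₀ * f₀ * f₀ + S₂)                ∎
    where
    open ≤-Reasoning
    g₀ = g zero
    f₀ = f zero
    S  = sum (λ i → g (suc i) * f (suc i))
    S₂ = sum (λ i → g (suc i) * f (suc i) * f (suc i))
    G  = sum (g ∘ suc)
    expand : ∀ g f S → (g * f + S) * (g * f + S) ≡ g * f * (g * f) + S * S + g * (2 * (f * S))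
    expand = solve-∀
    collect : ∀ g f S₂ G → g * f * (g * f) + G * S₂ + g * (S₂ + f * f * G) ≡ (g + G) * (g * f * f + S₂)
    collect = solve-∀

  anyFin⁺ : ∀ {n} {p : Fin n → Bool} i → p i ≡ true → anyFin p ≡ true
  anyFin⁺ {p = p} zero    pi≡true rewrite pi≡true = refl
  anyFin⁺ {p = p} (suc i) pi≡true with p zero
  ... | true  = refl
  ... | false = anyFin⁺ i pi≡true

  anyFin⁻ : ∀ {n} (p : Fin n → Bool) → anyFin p ≡ true → ∃[ i ] p i ≡ true
  anyFin⁻ {suc n} p any with p zero in p0
  ... | true  = zero , p0
  ... | false with anyFin⁻ (p ∘ suc) any
  ...   | i , pi = suc i , pi

  module _ {n : ℕ} (G : Digraph n) where

    walkB-refl : ∀ v → walkB G 0 v v ≡ true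
    walkB-refl v = trans (isYes≗does (v ≟ᶠ v)) (dec-true (v ≟ᶠ v) refl)

    walkB-zero⁻ : ∀ {u v} → walkB G 0 u v ≡ true → u ≡ v
    walkB-zero⁻ {u} {v} walk with u ≟ᶠ v
    ... | yes u≡v = u≡v

    walkB-step : ∀ {k u w v} → adj G u w ≡ true → walkB G k w v ≡ true → walkB G (suc k) u v ≡ true
    walkB-step {w = w} uw wv = anyFin⁺ w (∧-intro uw wv)

    walkB-step⁻ : ∀ {k u v} → walkB G (suc k) u v ≡ true → ∃[ w ] (adj G u w ≡ true × walkB G k w v ≡ true)
    walkB-step⁻ walk with anyFin⁻ _ walk
    ... | w , uw∧wv = w , ∧-elim uw∧wv

    walkB-snoc : ∀ {k u w v} → walkB G k u w ≡ true → adj G w v ≡ true → walkB G (suc k) u v ≡ true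
    walkB-snoc {zero} walk wv rewrite walkB-zero⁻ walk = walkB-step {0} wv (walkB-refl _)
    walkB-snoc {suc k} walk wv with walkB-step⁻ {k} walk
    ... | y , uy , yw = walkB-step {suc k} uy (walkB-snoc {k} yw wv)

    walkB-one⁻ : ∀ {u v} → walkB G 1 u v ≡ true → adj G u v ≡ true
    walkB-one⁻ walk with walkB-step⁻ {0} walk
    ... | w , uw , wv rewrite walkB-zero⁻ wv = uw

    walkB-zero-≢ : ∀ {u v} → u ≢ v → walkB G 0 u v ≡ false
    walkB-zero-≢ {u} {v} u≢v = trans (isYes≗does (u ≟ᶠ v)) (dec-false (u ≟ᶠ v) u≢v)

    adj⇒≢ : ∀ {x v} → adj G x v ≡ true → x ≢ v
    adj⇒≢ {x} xv refl = contradiction (trans (sym (noLoop G x)) xv) λ ()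

    adj⇒inM₁ : ∀ {x v} → adj G x v ≡ true → inM G 1 v x ≡ true
    adj⇒inM₁ {x} {v} xv =
      ∧-intro (walkB-step {0} xv (walkB-refl v)) (cong (λ b → not (b ∨ false)) (walkB-zero-≢ (adj⇒≢ xv)))

    module _ {side : Fin n → Bool} (bip : IsBipartition G side) where

      adj-flips-side : ∀ {u v} → adj G u v ≡ true → side v ≡ not (side u)
      adj-flips-side {u} {v} uv = ¬-not (edges-cross bip u v uv ∘ sym)

      walkB-side : ∀ k {u v} → walkB G k u v ≡ true → side v ≡ iterate not (side u) k
      walkB-side zero    walk = sym (cong side (walkB-zero⁻ walk))
      walkB-side (suc k) walk with walkB-step⁻ {k} walk
      ... | w , uw , wv = trans (walkB-side k wv) (cong (λ s → iterate not s k) (adj-flips-side uw))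

      walkB₃⇒inM₃ : ∀ {x v} → adj G x v ≡ false → walkB G 3 x v ≡ true → inM G 3 v x ≡ true
      walkB₃⇒inM₃ {x} {v} ¬xv x⇝v = ∧-intro x⇝v no-shorter-walk
        where
        side-v : side v ≡ not (side x)
        side-v = trans (walkB-side 3 x⇝v) (not-involutive (not (side x)))
        same-side-impossible : side v ≢ side x
        same-side-impossible eq = not-¬ refl (trans (sym eq) side-v)
        no-walk₂ : walkB G 2 x v ≢ true
        no-walk₂ walk = same-side-impossible (trans (walkB-side 2 walk) (not-involutive (side x)))
        no-walk₁ : walkB G 1 x v ≢ true
        no-walk₁ walk = contradiction (trans (sym ¬xv) (walkB-one⁻ walk)) λ ()
        no-walk₀ : walkB G 0 x v ≢ true
        no-walk₀ walk = same-side-impossible (cong side (sym (walkB-zero⁻ walk)))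
        no-shorter-walk : not (anyBelow 3 (λ j → walkB G j x v)) ≡ true
        no-shorter-walk rewrite ¬-not no-walk₂ | ¬-not no-walk₁ | ¬-not no-walk₀ = refl

  walkB-mono : ∀ {n} {H G : Digraph n} → (∀ {u v} → adj H u v ≡ true → adj G u v ≡ true) →
    ∀ k {u v} → walkB H k u v ≡ true → walkB G k u v ≡ true
  walkB-mono H⊆G zero    walk = walk
  walkB-mono {H = H} {G} H⊆G (suc k) walk with walkB-step⁻ H {k} walk
  ... | w , uw , wv = walkB-step G {k} (H⊆G uw) (walkB-mono H⊆G k wv)

  reach≤|M₁|+|M₃| : ∀ {n} {H G : Digraph n} {side : Fin n → Bool} → IsBipartition G side →
    (∀ {u v} → adj H u v ≡ true → adj G u v ≡ true) → ∀ v →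
    count (λ x → adj H x v ∨ walkB H 3 x v) ≤ sizeM G 1 v + sizeM G 3 v
  reach≤|M₁|+|M₃| {H = H} {G} bip H⊆G v =
    ≤-trans (count-mono in-M₁∪M₃) (count-∨-≤ (inM G 1 v) (inM G 3 v))
    where
    in-M₁∪M₃ : ∀ x → adj H x v ∨ walkB H 3 x v ≡ true → inM G 1 v x ∨ inM G 3 v x ≡ true
    in-M₁∪M₃ x reached with adj G x v in xv | adj H x v in hxv
    ... | true  | _     rewrite adj⇒inM₁ G xv = refl
    ... | false | true  = contradiction (trans (sym xv) (H⊆G hxv)) λ ()
    ... | false | false rewrite walkB₃⇒inM₃ G bip xv (walkB-mono {H = H} {G} H⊆G 3 reached) =
      ∨-zeroʳ (inM G 1 v x)

  module RegularOrientation {n : ℕ} (H : Digraph n) {side : Fin n → Bool} (bip : IsBipartition H side)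
    (oriented : ∀ {u v} → adj H u v ≡ true → adj H v u ≡ false)
    {m k : ℕ}
    (outdeg-A : ∀ {a} → side a ≡ true → count (adj H a) ≡ m)
    (outdeg-B : ∀ {b} → side b ≡ false → k ≤ count (adj H b))
    where

    #A #B : ℕ
    #A = count side
    #B = count (not ∘ side)

    new₃-pred : Fin n → Fin n → Bool
    new₃-pred v x = not (adj H x v) ∧ walkB H 3 x v

    indeg new₃ reach weight : Fin n → ℕ
    indeg  v = count (λ x → adj H x v)
    new₃   v = count (new₃-pred v)
    reach  v = count (λ x → adj H x v ∨ walkB H 3 x v)
    weight v = 𝟙 (not (side v)) * indeg v

    walkB₂-side : ∀ {x z} → walkB H 2 x z ≡ true → side z ≡ side x
    walkB₂-side {x} walk = trans (walkB-side H bip 2 walk) (not-involutive (side x))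

    A→B : ∀ {u v} → adj H u v ≡ true → side u ≡ true → side v ≡ false
    A→B uv su = trans (adj-flips-side H bip uv) (cong not su)

    two-paths≤new-out-neighbours : ∀ {x z} → side x ≡ true → side z ≡ true →
      count (λ v → adj H x v ∧ adj H v z) ≤ count (λ v → adj H z v ∧ not (adj H x v))
    two-paths≤new-out-neighbours {x} {z} sx sz = +-cancelˡ-≤ shared paths new (begin
      shared + paths                                     ≡⟨ +-comm shared paths ⟩
      paths + shared                                     ≤⟨ +-monoʳ-≤ paths (count-mono shared⊆) ⟩
      paths + count (λ v → adj H x v ∧ not (adj H v z))  ≡⟨ sym (count-split (adj H x) (λ v → adj H v z)) ⟩
      count (adj H x)                                    ≡⟨ trans (outdeg-A sx) (sym (outdeg-A sz)) ⟩
      count (adj H z)                                    ≡⟨ count-split (adj H z) (adj H x) ⟩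
      shared + new                                       ∎)
      where
      open ≤-Reasoning
      paths  = count (λ v → adj H x v ∧ adj H v z)
      shared = count (λ v → adj H z v ∧ adj H x v)
      new    = count (λ v → adj H z v ∧ not (adj H x v))
      shared⊆ : ∀ v → adj H z v ∧ adj H x v ≡ true → adj H x v ∧ not (adj H v z) ≡ true
      shared⊆ v zv∧xv with ∧-elim {adj H z v} zv∧xv
      ... | zv , xv rewrite xv | oriented zv = refl

    Triple : Fin n → Fin n → Fin n → Bool
    Triple x z v = side x ∧ (walkB H 2 x z ∧ (adj H z v ∧ not (adj H x v)))

    out-paths≤triples : ∀ x → 𝟙 (side x) * (m * k) ≤ sum (λ z → count (Triple x z))
    out-paths≤triples x with side x in sx
    ... | false = z≤n
    ... | true  = begin
      1 * (m * k)                                      ≡⟨ *-identityˡ (m * k) ⟩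
      m * k                                            ≡⟨ cong (_* k) (sym (outdeg-A sx)) ⟩
      count (adj H x) * k                              ≡⟨ count*≡∑𝟙* (adj H x) k ⟩
      sum (λ v → 𝟙 (adj H x v) * k)                    ≤⟨ sum-mono-≤ out-neighbour-outdeg ⟩
      sum (λ v → 𝟙 (adj H x v) * count (adj H v))      ≡⟨ sum-cong-≗ (λ v → 𝟙*count (adj H x v) (adj H v)) ⟩
      sum (λ v → count (λ z → adj H x v ∧ adj H v z))  ≡⟨ ∑-count-comm (λ v z → adj H x v ∧ adj H v z) ⟩
      sum (λ z → count (λ v → adj H x v ∧ adj H v z))  ≤⟨ sum-mono-≤ paths≤ ⟩
      sum (λ z → 𝟙 (walkB H 2 x z) * new-out z)        ≡⟨ sum-cong-≗ (λ z → 𝟙*count (walkB H 2 x z) (new-out-pred z)) ⟩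
      sum (λ z → count (λ v → walkB H 2 x z ∧ (adj H z v ∧ not (adj H x v)))) ∎
      where
      open ≤-Reasoning
      new-out-pred : Fin n → Fin n → Bool
      new-out-pred z v = adj H z v ∧ not (adj H x v)
      new-out : Fin n → ℕ
      new-out z = count (new-out-pred z)
      out-neighbour-outdeg : ∀ v → 𝟙 (adj H x v) * k ≤ 𝟙 (adj H x v) * count (adj H v)
      out-neighbour-outdeg v with adj H x v in xv
      ... | false = z≤n
      ... | true  = *-monoʳ-≤ 1 (outdeg-B (A→B xv sx))
      paths≤ : ∀ z → count (λ v → adj H x v ∧ adj H v z) ≤ 𝟙 (walkB H 2 x z) * new-out z
      paths≤ z with walkB H 2 x z in x⇝z
      ... | true  = ≤-trans (two-paths≤new-out-neighbours sx (trans (walkB₂-side x⇝z) sx))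
                            (≤-reflexive (sym (*-identityˡ (new-out z))))
      ... | false = ≤-trans (count-mono {q = λ _ → false} no-path) (≤-reflexive (count-false n))
        where
        no-path : ∀ v → adj H x v ∧ adj H v z ≡ true → false ≡ true
        no-path v xv∧vz with ∧-elim {adj H x v} xv∧vz
        ... | xv , vz = trans (sym x⇝z) (walkB-step H {1} xv (walkB-step H {0} vz (walkB-refl H z)))

    -- A triple (x, z, v) yields the in-neighbour z of v ∈ B and the vertex x counted in new₃ v.
    Witness : Fin n → Fin n → Fin n → Bool
    Witness x z v = (not (side v) ∧ adj H z v) ∧ new₃-pred v x

    Triple⊆Witness : ∀ x z v → Triple x z v ≡ true → Witness x z v ≡ true
    Triple⊆Witness x z v triple with ∧-elim {side x} triple
    ... | sx , rest with ∧-elim {walkB H 2 x z} rest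
    ... | x⇝z , zv∧¬xv with ∧-elim {adj H z v} zv∧¬xv
    ... | zv , ¬xv = ∧-intro (∧-intro (cong not (A→B zv (trans (walkB₂-side x⇝z) sx))) zv)
                             (∧-intro ¬xv (walkB-snoc H {2} x⇝z zv))

    triples≤weighted-new₃ : sum (λ x → sum (λ z → count (Triple x z))) ≤ sum (λ v → weight v * new₃ v)
    triples≤weighted-new₃ = begin
      sum (λ x → sum (λ z → count (Triple x z)))
        ≤⟨ sum-mono-≤ (λ x → sum-mono-≤ (λ z → count-mono (Triple⊆Witness x z))) ⟩
      sum (λ x → sum (λ z → count (Witness x z)))            ≡⟨ ∑-comm (λ x z → count (Witness x z)) ⟩
      sum (λ z → sum (λ x → count (Witness x z)))
        ≡⟨ sum-cong-≗ (λ z → ∑-count-comm (λ x → Witness x z)) ⟩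
      sum (λ z → sum (λ v → count (λ x → Witness x z v)))
        ≡⟨ ∑-comm (λ z v → count (λ x → Witness x z v)) ⟩
      sum (λ v → sum (λ z → count (λ x → Witness x z v)))
        ≡⟨ sum-cong-≗ (λ v → sum-cong-≗ (λ z → sym (𝟙*count (not (side v) ∧ adj H z v) (new₃-pred v)))) ⟩
      sum (λ v → sum (λ z → 𝟙 (not (side v) ∧ adj H z v) * new₃ v))
        ≡⟨ sum-cong-≗ (λ v → sym (count*≡∑𝟙* (λ z → not (side v) ∧ adj H z v) (new₃ v))) ⟩
      sum (λ v → count (λ z → not (side v) ∧ adj H z v) * new₃ v)
        ≡⟨ sum-cong-≗ (λ v → cong (_* new₃ v) (sym (𝟙*count (not (side v)) (λ z → adj H z v)))) ⟩
      sum (λ v → weight v * new₃ v)                          ∎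
      where open ≤-Reasoning

    ∑weight≡m*#A : sum weight ≡ m * #A
    ∑weight≡m*#A = begin
      sum weight
        ≡⟨ sum-cong-≗ (λ v → 𝟙*count (not (side v)) (λ x → adj H x v)) ⟩
      sum (λ v → count (λ x → not (side v) ∧ adj H x v))
        ≡⟨ ∑-count-comm (λ v x → not (side v) ∧ adj H x v) ⟩
      sum (λ x → count (λ v → not (side v) ∧ adj H x v))
        ≡⟨ sum-cong-≗ (λ x → count-cong (in-B⇔from-A x)) ⟩
      sum (λ x → count (λ v → side x ∧ adj H x v))
        ≡⟨ sum-cong-≗ (λ x → sym (𝟙*count (side x) (adj H x))) ⟩
      sum (λ x → 𝟙 (side x) * count (adj H x))  ≡⟨ sum-cong-≗ outdeg-from-A ⟩
      sum (λ x → 𝟙 (side x) * m)                ≡⟨ sym (count*≡∑𝟙* side m) ⟩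
      #A * m                                    ≡⟨ *-comm #A m ⟩
      m * #A                                    ∎
      where
      open ≡-Reasoning
      in-B⇔from-A : ∀ x v → not (side v) ∧ adj H x v ≡ side x ∧ adj H x v
      in-B⇔from-A x v with adj H x v in xv
      ... | false = trans (∧-zeroʳ _) (sym (∧-zeroʳ _))
      ... | true  rewrite adj-flips-side H bip xv = cong (_∧ true) (not-involutive (side x))
      outdeg-from-A : ∀ x → 𝟙 (side x) * count (adj H x) ≡ 𝟙 (side x) * m
      outdeg-from-A x with side x in sx
      ... | true  = cong (1 *_) (outdeg-A sx)
      ... | false = refl

    k*m*#A≤∑weight*new₃ : k * (m * #A) ≤ sum (λ v → weight v * new₃ v)
    k*m*#A≤∑weight*new₃ = begin
      k * (m * #A)                                   ≡⟨ reorder k m #A ⟩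
      #A * (m * k)                                   ≡⟨ count*≡∑𝟙* side (m * k) ⟩
      sum (λ x → 𝟙 (side x) * (m * k))               ≤⟨ sum-mono-≤ out-paths≤triples ⟩
      sum (λ x → sum (λ z → count (Triple x z)))     ≤⟨ triples≤weighted-new₃ ⟩
      sum (λ v → weight v * new₃ v)                  ∎
      where
      open ≤-Reasoning
      reorder : ∀ k m a → k * (m * a) ≡ a * (m * k)
      reorder = solve-∀

    ∑weight*reach : sum (λ v → weight v * reach v) ≡
                    sum (λ v → weight v * indeg v) + sum (λ v → weight v * new₃ v)
    ∑weight*reach = trans (sum-cong-≗ split) (∑-distrib-+ (λ v → weight v * indeg v) (λ v → weight v * new₃ v))
      where
      split : ∀ v → weight v * reach v ≡ weight v * indeg v + weight v * new₃ v
      split v = trans (cong (weight v *_) (count-∨ (λ x → adj H x v) (λ x → walkB H 3 x v)))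
                      (*-distribˡ-+ (weight v) (indeg v) (new₃ v))

    weighted-reach-bound : (m * #A + k * #B) * sum weight ≤ sum (λ v → weight v * (reach v * #B))
    weighted-reach-bound = begin
      (m * #A + k * #B) * D                      ≡⟨ cong (λ d → (d + k * #B) * D) (sym ∑weight≡m*#A) ⟩
      (D + k * #B) * D                           ≡⟨ expand D k #B ⟩
      D * D + #B * (k * D)                       ≡⟨ cong (λ d → D * D + #B * (k * d)) ∑weight≡m*#A ⟩
      D * D + #B * (k * (m * #A))                ≤⟨ +-mono-≤ D²≤#B*X (*-monoʳ-≤ #B k*m*#A≤∑weight*new₃) ⟩
      #B * X + #B * Y                            ≡⟨ sym (*-distribˡ-+ #B X Y) ⟩
      #B * (X + Y)                               ≡⟨ cong (#B *_) (sym ∑weight*reach) ⟩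
      #B * sum (λ v → weight v * reach v)        ≡⟨ *-distribˡ-sum #B (λ v → weight v * reach v) ⟩
      sum (λ v → #B * (weight v * reach v))      ≡⟨ sum-cong-≗ (λ v → reorder #B (weight v) (reach v)) ⟩
      sum (λ v → weight v * (reach v * #B))      ∎
      where
      open ≤-Reasoning
      D = sum weight
      X = sum (λ v → weight v * indeg v)
      Y = sum (λ v → weight v * new₃ v)
      expand : ∀ d k b → (d + k * b) * d ≡ d * d + b * (k * d)
      expand = solve-∀
      reorder : ∀ b w r → b * (w * r) ≡ w * (r * b)
      reorder = solve-∀
      D²≤#B*X : D * D ≤ #B * X
      D²≤#B*X = subst (λ b → D * D ≤ b * X) (sym (count≡sum (not ∘ side)))
                  (cauchy-schwarz (𝟙 ∘ not ∘ side) indeg)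

    ∃-reach-bound : 0 < m → 0 < #A → ∃[ v ] (side v ≡ false × m * #A + k * #B ≤ reach v * #B)
    ∃-reach-bound 0<m 0<#A =
      let v , 0<weight , bound = ∃-above-average weight (λ v → reach v * #B) (m * #A + k * #B)
                                   0<∑weight weighted-reach-bound
      in v , weighted⇒B 0<weight , bound
      where
      0<∑weight : 0 < sum weight
      0<∑weight = subst (0 <_) (sym ∑weight≡m*#A) (*-mono-< 0<m 0<#A)
      weighted⇒B : ∀ {v} → 0 < weight v → side v ≡ false
      weighted⇒B {v} 0<w with side v
      ... | false = refl
      ... | true  = contradiction 0<w λ ()

  module _ {n : ℕ} (G : Digraph n) (side : Fin n → Bool) (m : ℕ) where

    trimmedAdj : Fin n → Fin n → Bool
    trimmedAdj u = if side u then keepFirst m (λ w → adj G u w ∧ not (side w)) else adj G u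

    trimmedAdj⊆adj : ∀ {u v} → trimmedAdj u v ≡ true → adj G u v ≡ true
    trimmedAdj⊆adj {u} {v} with side u
    ... | true  = proj₁ ∘ ∧-elim {adj G u v} ∘ keepFirst⊆ m _
    ... | false = id

    trim : Digraph n
    adj trim = trimmedAdj
    noLoop trim u = ¬-not λ uu → contradiction (trans (sym (noLoop G u)) (trimmedAdj⊆adj uu)) λ ()

    trim-bipartition : IsBipartition G side → IsBipartition trim side
    trim-bipartition bip = record
      { A-nonempty  = A-nonempty bip
      ; B-nonempty  = B-nonempty bip
      ; edges-cross = λ u v uv → edges-cross bip u v (trimmedAdj⊆adj uv)
      }

    trim-oriented : ¬ HasCycle2 G → ∀ {u v} → adj trim u v ≡ true → adj trim v u ≡ false
    trim-oriented no-2-cycle {u} {v} uv = ¬-not λ vu →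
      no-2-cycle (u , v , adj⇒≢ G (trimmedAdj⊆adj uv) , trimmedAdj⊆adj uv , trimmedAdj⊆adj vu)

    trim-outdeg-A : (∀ a → side a ≡ true → m ≤ outdegIn G (inB side) a) →
      ∀ {a} → side a ≡ true → count (adj trim a) ≡ m
    trim-outdeg-A m≤ {a} sa rewrite sa = count-keepFirst m (λ w → adj G a w ∧ not (side w)) (m≤ a sa)

    trim-outdeg-B : ∀ {k} → (∀ b → side b ≡ false → k ≤ outdegIn G (inA side) b) →
      ∀ {b} → side b ≡ false → k ≤ count (adj trim b)
    trim-outdeg-B k≤ {b} sb rewrite sb = ≤-trans (k≤ b sb) (count-mono λ w → proj₁ ∘ ∧-elim {adj G b w})

  ∃-M₁₃-bound : ∀ {n} (G : Digraph n) {side : Fin n → Bool} → IsBipartition G side → ¬ HasCycle2 G →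
    ∀ {m k} → (∀ a → side a ≡ true → m ≤ outdegIn G (inB side) a) →
    (∀ b → side b ≡ false → k ≤ outdegIn G (inA side) b) → 0 < m →
    ∃[ v ] (side v ≡ false ×
      m * count (inA side) + k * count (inB side) ≤ (sizeM G 1 v + sizeM G 3 v) * count (inB side))
  ∃-M₁₃-bound G {side} bip no-2-cycle {m} m≤ k≤ 0<m =
    let v , v∈B , bound = ∃-reach-bound 0<m (count-pos {p = side} a a∈A)
    in v , v∈B , ≤-trans bound (*-monoˡ-≤ #B (reach≤|M₁|+|M₃| {H = trim G side m} bip H⊆G v))
    where
    open RegularOrientation (trim G side m) (trim-bipartition G side m bip) (trim-oriented G side m no-2-cycle)
      (trim-outdeg-A G side m m≤) (trim-outdeg-B G side m k≤)
    H⊆G = trimmedAdj⊆adj G side m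
    a   = proj₁ (A-nonempty bip)
    a∈A = proj₂ (A-nonempty bip)

  module _ where
    open import Data.Integer using (+_)
    import Data.Integer as ℤ
    import Data.Integer.Properties as ℤ
    open import Data.Rational as ℚ using (ℚ; mkℚ; 0ℚ; *≤*; Positive; NonNegative)
    import Data.Rational.Properties as ℚ
    open import Data.Rational.Solver using (module +-*-Solver)
    open import Data.Nat.Coprimality using (1-coprimeTo)
    import Data.Nat.Coprimality as Coprime

    -- In normal form, sums and products of the rationals ℕ→ℚ a reduce to ℤ arithmetic.
    ℕ→ℚ≡mkℚ : ∀ k → ℕ→ℚ k ≡ mkℚ (+ k) 0 (Coprime.sym (1-coprimeTo k))
    ℕ→ℚ≡mkℚ k = ℚ.↥p/↧p≡p (mkℚ (+ k) 0 (Coprime.sym (1-coprimeTo k)))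

    ℕ→ℚ-+ : ∀ a b → ℕ→ℚ (a + b) ≡ ℕ→ℚ a ℚ.+ ℕ→ℚ b
    ℕ→ℚ-+ a b rewrite ℕ→ℚ≡mkℚ a | ℕ→ℚ≡mkℚ b =
      cong (ℚ._/ 1) (sym (trans (cong₂ ℤ._+_ (ℤ.*-identityʳ (+ a)) (ℤ.*-identityʳ (+ b))) (sym (ℤ.pos-+ a b))))

    ℕ→ℚ-* : ∀ a b → ℕ→ℚ (a * b) ≡ ℕ→ℚ a ℚ.* ℕ→ℚ b
    ℕ→ℚ-* a b rewrite ℕ→ℚ≡mkℚ a | ℕ→ℚ≡mkℚ b = cong (ℚ._/ 1) (ℤ.pos-* a b)

    ℕ→ℚ-mono-≤ : ∀ {a b} → a ≤ b → ℕ→ℚ a ℚ.≤ ℕ→ℚ b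
    ℕ→ℚ-mono-≤ {a} {b} a≤b rewrite ℕ→ℚ≡mkℚ a | ℕ→ℚ≡mkℚ b =
      *≤* (subst₂ ℤ._≤_ (sym (ℤ.*-identityʳ (+ a))) (sym (ℤ.*-identityʳ (+ b))) (ℤ.+≤+ a≤b))

    ℕ→ℚ-nonNeg : ∀ a → NonNegative (ℕ→ℚ a)
    ℕ→ℚ-nonNeg a rewrite ℕ→ℚ≡mkℚ a = _

    ℕ→ℚ-pos : ∀ {a} → 0 < a → Positive (ℕ→ℚ a)
    ℕ→ℚ-pos {suc a} _ rewrite ℕ→ℚ≡mkℚ (suc a) = _

    pos*ℕ≤ℕ⇒pos : ∀ {β b m} → 0ℚ ℚ.< β → 0 < b → β ℚ.* ℕ→ℚ b ℚ.≤ ℕ→ℚ m → 0 < m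
    pos*ℕ≤ℕ⇒pos {m = suc m} _ _ _ = s≤s z≤n
    pos*ℕ≤ℕ⇒pos {β} {b} {zero} 0<β 0<b βb≤0 = contradiction (ℚ.<-≤-trans 0<βb βb≤0) (ℚ.<-irrefl refl)
      where
      0<βb : 0ℚ ℚ.< β ℚ.* ℕ→ℚ b
      0<βb = ℚ.positive⁻¹ _ {{ℚ.pos*pos⇒pos β {{ℚ.positive 0<β}} (ℕ→ℚ b) {{ℕ→ℚ-pos 0<b}}}}

    scale-bounds : ∀ (α β : ℚ) {a b} m k r → 0 < b →
      β ℚ.* ℕ→ℚ b ℚ.≤ ℕ→ℚ m → α ℚ.* ℕ→ℚ a ℚ.≤ ℕ→ℚ k →
      m * a + k * b ≤ r * b → (α ℚ.+ β) ℚ.* ℕ→ℚ a ℚ.≤ ℕ→ℚ r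
    scale-bounds α β {a} {b} m k r 0<b βb≤m αa≤k ma+kb≤rb =
      ℚ.*-cancelʳ-≤-pos B {{ℕ→ℚ-pos 0<b}} (begin
        (α ℚ.+ β) ℚ.* A ℚ.* B                 ≡⟨ regroup ⟩
        α ℚ.* A ℚ.* B ℚ.+ β ℚ.* B ℚ.* A
          ≤⟨ ℚ.+-mono-≤ (ℚ.*-monoʳ-≤-nonNeg B αa≤k) (ℚ.*-monoʳ-≤-nonNeg A βb≤m) ⟩
        ℕ→ℚ k ℚ.* B ℚ.+ ℕ→ℚ m ℚ.* A
          ≡⟨ sym (trans (ℕ→ℚ-+ (k * b) (m * a)) (cong₂ ℚ._+_ (ℕ→ℚ-* k b) (ℕ→ℚ-* m a))) ⟩
        ℕ→ℚ (k * b + m * a)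
          ≤⟨ ℕ→ℚ-mono-≤ (subst (_≤ r * b) (+-comm (m * a) (k * b)) ma+kb≤rb) ⟩
        ℕ→ℚ (r * b)                           ≡⟨ ℕ→ℚ-* r b ⟩
        ℕ→ℚ r ℚ.* B                           ∎)
      where
      open ℚ.≤-Reasoning
      A = ℕ→ℚ a
      B = ℕ→ℚ b
      instance
        _ : NonNegative A
        _ = ℕ→ℚ-nonNeg a
        _ : NonNegative B
        _ = ℕ→ℚ-nonNeg b
      regroup : (α ℚ.+ β) ℚ.* A ℚ.* B ≡ α ℚ.* A ℚ.* B ℚ.+ β ℚ.* B ℚ.* A
      regroup = solve 4 (λ α β A B → (α :+ β) :* A :* B := α :* A :* B :+ β :* B :* A) refl α β A B
        where open +-*-Solver

open import Data.Nat using (ℕ) renaming (_+_ to _+ℕ_)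
open import Data.Rational using (ℚ; 0ℚ; _<_; _≤_; _+_; _*_)

mainTheorem7 : (α β : ℚ) → 0ℚ < α → 0ℚ < β →
    {n : ℕ} (G : Digraph n) (side : Fin n → Bool) →
    Compliant α β G side →
    ¬ HasCycle2 G → ¬ HasCycle3 G →
    ∃[ v ] (side v ≡ false ×
      (α + β) * ℕ→ℚ (count (inA side)) ≤ ℕ→ℚ (sizeM G 1 v +ℕ sizeM G 3 v))
mainTheorem7 α β _ 0<β G side compliant no-2-cycle _ =
  let a₀ , a₀∈A , a₀-min = ∃-argmin (λ a → side a ≟ᵇ true) (outdegIn G (inB side)) (A-nonempty bip)
      b₀ , b₀∈B , b₀-min = ∃-argmin (λ b → side b ≟ᵇ false) (outdegIn G (inA side)) (B-nonempty bip)
      m = outdegIn G (inB side) a₀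
      k = outdegIn G (inA side) b₀
      0<#B = count-pos (proj₁ (B-nonempty bip)) (cong not (proj₂ (B-nonempty bip)))
      βb≤m = A-deg compliant a₀ a₀∈A
      v , v∈B , bound = ∃-M₁₃-bound G bip no-2-cycle a₀-min b₀-min (pos*ℕ≤ℕ⇒pos 0<β 0<#B βb≤m)
  in v , v∈B , scale-bounds α β m k (sizeM G 1 v +ℕ sizeM G 3 v) 0<#B βb≤m (B-deg compliant b₀ b₀∈B) bound
  where
  bip = bipartition compliant
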